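{- Let $(V,\mathcal{B})$ be a $(v,k,1)$-BIBD and let $\Gamma$ be the bipartite graph with vertex set $V\sqcup\mathcal{B}$ and edges $\{x,B\}$ for $x\in V$, $B\in\mathcal{B}$ with $x\in B$. Apply the Weisfeiler–Leman algorithm to $\Gamma$. Then the resulting stable colouring does not distinguish any two elements of $V$ and does not distinguish any two elements of $\mathcal{B}$: for all $x,y\in V$ the colours of $(x,x)$ and $(y,y)$ coincide, and for all $B,B'\in\mathcal{B}$ the colours of $(B,B)$ and $(B',B')$ coincide (so at best the colouring distinguishes $V$ from $\mathcal{B}$).
   Context: A $(v,k,\lambda)$-BIBD is a pair $(V,\mathcal{B})$ where $V$ is a finite set of $v$ points and $\mathcal{B}$ is a set (no repeated blocks) of $k$-subsets of $V$, $k>1$, such that every pair of distinct points lies in exactly $\lambda$ blocks; trivial cases are excluded. The (2-dimensional) Weisfeiler–Leman algorithm on a graph $\Gamma$ with vertex set $X$ colours $X^{2}$: initially $c_{0}(x,x)=$ "vertex", $c_{0}(x,y)=$ "edge" if $\{x,y\}$ is an edge and "non-edge" otherwise ($x\neq y$); at each step $c_{j+1}(x,y)$ is the pair consisting of $c_{j}(x,y)$ and the multiset $\{\!\{(c_{j}(x,z),c_{j}(z,y)) : z\in X\}\!\}$; the algorithm stops when the partition of $X^{2}$ into colour classes no longer gets finer, and the colour of a vertex $x$ is the final colour of $(x,x)$. -}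

module Defs where

open import Data.Bool using (Bool; true; false; _∧_)
open import Data.Nat as ℕ using (ℕ; zero; suc; _≤_; _<_; _≡ᵇ_)
open import Data.Fin as Fin using (Fin; splitAt)
open import Data.Fin.Subset using (Subset; ∣_∣)
open import Data.Fin.Subset.Properties using (_∈?_)
open import Data.List using (List; length; filterᵇ; allFin; cartesianProduct)
open import Data.Bool.ListAction using (all)
open import Data.Product using (_×_; _,_)
open import Data.Sum using (_⊎_; inj₁; inj₂)
open import Relation.Nullary using (does)
open import Relation.Binary.PropositionalEquality using (_≡_; _≢_)

blocksThrough : ∀ {v b} → (Fin b → Subset v) → Fin v → Fin v → ℕ
blocksThrough {v} {b} B x y =
  length (filterᵇ (λ i → does (x ∈? B i) ∧ does (y ∈? B i)) (allFin b))

record IsBIBD (v k lam b : ℕ) (B : Fin b → Subset v) : Set where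
  field
    k>1       : 2 ≤ k
    k<v       : k < v
    blockSize : ∀ i → ∣ B i ∣ ≡ k
    noRepeat  : ∀ i j → B i ≡ B j → i ≡ j
    balanced  : ∀ x y → x ≢ y → blocksThrough B x y ≡ lam

-- Incidence (Levi) graph on V ⊔ 𝓑, realised on Fin (v + b):
-- x ↑ˡ b is the point x, v ↑ʳ i is the block i.

incidenceAdj : ∀ {v b} → (Fin b → Subset v) → Fin (v ℕ.+ b) → Fin (v ℕ.+ b) → Bool
incidenceAdj {v} B u w with splitAt v u | splitAt v w
... | inj₁ x | inj₂ i = does (x ∈? B i)
... | inj₂ i | inj₁ x = does (x ∈? B i)
... | inj₁ _ | inj₁ _ = false
... | inj₂ _ | inj₂ _ = false

-- The colouring c_j of X² is represented by its
-- partition into colour classes: sameColour j p q ≡ true iff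
-- c_j(p) = c_j(q).

data Colour₀ : Set where
  vertex edge non-edge : Colour₀

_==₀_ : Colour₀ → Colour₀ → Bool
vertex   ==₀ vertex   = true
edge     ==₀ edge     = true
non-edge ==₀ non-edge = true
_        ==₀ _        = false

module WL (n : ℕ) (adj : Fin n → Fin n → Bool) where

  Pair : Set
  Pair = Fin n × Fin n

  pairs : List Pair
  pairs = cartesianProduct (allFin n) (allFin n)

  c₀ : Pair → Colour₀
  c₀ (x , y) with does (x Fin.≟ y) | adj x y
  ... | true  | _     = vertex
  ... | false | true  = edge
  ... | false | false = non-edge

  mutual
    sameColour : ℕ → Pair → Pair → Bool
    sameColour zero    p q = c₀ p ==₀ c₀ q
    sameColour (suc j) p q =
      sameColour j p q ∧
      all (λ r → all (λ s → mult j p r s ≡ᵇ mult j q r s) pairs) pairs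

    -- multiplicity of the pair of colours (c_j(r), c_j(s)) in the
    -- multiset {{ (c_j(x,z), c_j(z,y)) : z ∈ X }}
    mult : ℕ → Pair → Pair → Pair → ℕ
    mult j (x , y) r s =
      length (filterᵇ (λ z → sameColour j (x , z) r ∧ sameColour j (z , y) s) (allFin n))

  sameVertexColour : ℕ → Fin n → Fin n → Bool
  sameVertexColour j x y = sameColour j (x , x) (y , y)

-- Classify the ordered pairs of vertices of the incidence graph by
-- their "type": two points are equal or not, a point and a block are
-- incident or not, and two blocks are identical, intersecting or disjoint.
-- This classification is a coherent configuration: it refines the initial
-- colouring, and for every pair (x , y) the number of z with (x , z) of type c
-- and (z , y) of type d depends only on the type of (x , y).  By induction on
-- the rounds, Weisfeiler–Leman never separates two pairs of the same type;
-- all points have the same diagonal type, and so do all blocks.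

module Submission where

open import Defs
open import Data.Nat using (ℕ; _+_)
open import Data.Fin using (Fin; _↑ˡ_; _↑ʳ_)
open import Data.Fin.Subset using (Subset)
open import Data.Bool using (true)
open import Data.Product using (_×_)
open import Relation.Binary.PropositionalEquality using (_≡_)

open import Data.Nat.Properties using (+-*-semiring)
open import Algebra.Properties.Semiring.Sum +-*-semiring
  using (sum; sum-syntax; sum-cong-≗; sum-replicate-zero; ∑-distrib-+; ∑-comm; *-distribˡ-sum; *-distribʳ-sum)
open import Data.Bool using (Bool; false; _∧_; not; if_then_else_)
open import Data.Bool.ListAction using (all; any; and)
open import Data.Bool.Properties using (∧-comm; ∧-idem)
import Data.Bool.Properties as Bool
open import Data.Fin using (_≟_; splitAt; join; fromℕ<)
open import Data.Fin.Properties using (splitAt-↑ˡ; splitAt-↑ʳ; join-splitAt)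
open import Data.Fin.Subset using (∣_∣; inside; outside)
open import Data.Fin.Subset.Properties using (_∈?_)
open import Data.List using (List; []; _∷_; length; filterᵇ; tabulate; allFin)
open import Data.List.Membership.Propositional using (_∈_)
open import Data.List.Membership.Propositional.Properties using (∈-cartesianProduct⁺; ∈-allFin)
open import Data.List.Properties using (map-cong)
open import Data.List.Relation.Unary.Any using (here; there)
open import Data.Nat using (zero; suc; _*_; _≤_; z≤n; s≤s; _≡ᵇ_)
open import Data.Nat.Properties
  using (+-identityʳ; +-assoc; +-comm; +-suc; +-cancelˡ-≡; +-cancelʳ-≡; +-monoʳ-≤; m≤m+n; ≤-trans;
         *-comm; *-assoc; *-zeroʳ; *-identityˡ; *-identityʳ; *-distribˡ-+; *-cancelʳ-≡)
open import Data.Nat.Solver using (module +-*-Solver)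
open import Data.Product using (Σ-syntax; _,_; proj₁; proj₂)
open import Data.Sum using (_⊎_; inj₁; inj₂)
open import Data.Sum.Properties using (≡-dec; inj₁-injective; inj₂-injective)
open import Data.Vec using ([]; _∷_)
open import Function using (_∘_; id)
open import Relation.Binary.Definitions using (DecidableEquality)
open import Relation.Binary.PropositionalEquality
  using (_≢_; refl; sym; trans; cong; cong₂; subst; module ≡-Reasoning)
open import Relation.Nullary using (does; yes; no; contradiction)
open import Relation.Nullary.Decidable using (dec-true; dec-false)
open +-*-Solver using (solve; _:+_; _:*_; _:=_; con)

⟦_⟧ : Bool → ℕ
⟦ true ⟧  = 1
⟦ false ⟧ = 0

⟦∧⟧ : ∀ a c → ⟦ a ∧ c ⟧ ≡ ⟦ a ⟧ * ⟦ c ⟧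
⟦∧⟧ true  c = sym (+-identityʳ ⟦ c ⟧)
⟦∧⟧ false c = refl

⟦⟧-idem : ∀ a → ⟦ a ⟧ * ⟦ a ⟧ ≡ ⟦ a ⟧
⟦⟧-idem true  = refl
⟦⟧-idem false = refl

split-by : ∀ c x → x ≡ ⟦ c ⟧ * x + ⟦ not c ⟧ * x
split-by true  x = sym (trans (+-identityʳ _) (+-identityʳ x))
split-by false x = sym (+-identityʳ x)

count : ∀ {n} → (Fin n → Bool) → ℕ
count {n} p = ∑[ z < n ] ⟦ p z ⟧

count-cong : ∀ {n} {p q : Fin n → Bool} → (∀ z → p z ≡ q z) → count p ≡ count q
count-cong p≗q = sum-cong-≗ (λ z → cong ⟦_⟧ (p≗q z))

count-true : ∀ n → count {n} (λ _ → true) ≡ n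
count-true zero    = refl
count-true (suc n) = cong suc (count-true n)

length-filter-tabulate : ∀ {A : Set} {n} (q : A → Bool) (f : Fin n → A) →
  length (filterᵇ q (tabulate f)) ≡ count (q ∘ f)
length-filter-tabulate {n = zero}  q f = refl
length-filter-tabulate {n = suc n} q f with q (f Fin.zero)
... | true  = cong suc (length-filter-tabulate q (f ∘ Fin.suc))
... | false = length-filter-tabulate q (f ∘ Fin.suc)

length-filter-allFin : ∀ {n} (p : Fin n → Bool) → length (filterᵇ p (allFin n)) ≡ count p
length-filter-allFin p = length-filter-tabulate p id

∑-*ˡ : ∀ {n} c (f : Fin n → ℕ) → ∑[ i < n ] (c * f i) ≡ c * sum f
∑-*ˡ c f = sym (*-distribˡ-sum c f)

∑-*ʳ : ∀ {n} c (f : Fin n → ℕ) → ∑[ i < n ] (f i * c) ≡ sum f * c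
∑-*ʳ c f = sym (*-distribʳ-sum c f)

_≐_ : ∀ {n} → Fin n → Fin n → Bool
x ≐ y = does (x ≟ y)

≐-refl : ∀ {n} (x : Fin n) → (x ≐ x) ≡ true
≐-refl Fin.zero    = refl
≐-refl (Fin.suc x) = ≐-refl x

≐-sym : ∀ {n} (x y : Fin n) → (x ≐ y) ≡ (y ≐ x)
≐-sym Fin.zero    Fin.zero    = refl
≐-sym Fin.zero    (Fin.suc y) = refl
≐-sym (Fin.suc x) Fin.zero    = refl
≐-sym (Fin.suc x) (Fin.suc y) = ≐-sym x y

∑-δ : ∀ {n} (x : Fin n) (g : Fin n → ℕ) → ∑[ w < n ] (⟦ x ≐ w ⟧ * g w) ≡ g x
∑-δ {suc n} Fin.zero    g =
  trans (cong₂ _+_ (+-identityʳ (g Fin.zero)) (sum-replicate-zero n)) (+-identityʳ _)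
∑-δ {suc n} (Fin.suc x) g = ∑-δ x (g ∘ Fin.suc)

count-δ : ∀ {n} (x : Fin n) → count (x ≐_) ≡ 1
count-δ x = trans (sum-cong-≗ (λ w → sym (*-identityʳ ⟦ x ≐ w ⟧))) (∑-δ x (λ _ → 1))

∑-isolate : ∀ {n} (j : Fin n) (f : Fin n → ℕ) →
  sum f ≡ f j + ∑[ l < n ] (⟦ not (j ≐ l) ⟧ * f l)
∑-isolate {n} j f = begin
  sum f                                                    ≡⟨ sum-cong-≗ (λ l → split-by (j ≐ l) (f l)) ⟩
  ∑[ l < n ] (⟦ j ≐ l ⟧ * f l + ⟦ not (j ≐ l) ⟧ * f l)   ≡⟨ ∑-distrib-+ (λ l → ⟦ j ≐ l ⟧ * f l) (λ l → ⟦ not (j ≐ l) ⟧ * f l) ⟩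
  ∑[ l < n ] (⟦ j ≐ l ⟧ * f l) + ∑[ l < n ] (⟦ not (j ≐ l) ⟧ * f l)
                                                           ≡⟨ cong (_+ ∑[ l < n ] (⟦ not (j ≐ l) ⟧ * f l)) (∑-δ j f) ⟩
  f j + ∑[ l < n ] (⟦ not (j ≐ l) ⟧ * f l)               ∎
  where open ≡-Reasoning

∑-↑ : ∀ v {b} (f : Fin (v + b) → ℕ) →
  sum f ≡ ∑[ x < v ] f (x ↑ˡ b) + ∑[ i < b ] f (v ↑ʳ i)
∑-↑ zero    f = refl
∑-↑ (suc v) {b} f = trans (cong (f Fin.zero +_) (∑-↑ v (f ∘ Fin.suc)))
  (sym (+-assoc (f Fin.zero) (∑[ x < v ] f (Fin.suc (x ↑ˡ b))) (∑[ i < b ] f (Fin.suc (v ↑ʳ i)))))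

term≤sum : ∀ {n} (j : Fin n) (f : Fin n → ℕ) → f j ≤ sum f
term≤sum j f = subst (f j ≤_) (sym (∑-isolate j f)) (m≤m+n (f j) _)

two-terms≤sum : ∀ {n} (i j : Fin n) → i ≢ j → (f : Fin n → ℕ) → f i + f j ≤ sum f
two-terms≤sum {n} i j i≢j f = subst (f i + f j ≤_) (sym (∑-isolate i f)) (+-monoʳ-≤ (f i) fj≤rest)
  where
  fj≤rest : f j ≤ ∑[ l < n ] (⟦ not (i ≐ l) ⟧ * f l)
  fj≤rest = subst (_≤ ∑[ l < n ] (⟦ not (i ≐ l) ⟧ * f l))
                  (trans (cong (λ c → ⟦ not c ⟧ * f j) (dec-false (i ≟ j) i≢j)) (+-identityʳ (f j)))
                  (term≤sum j (λ l → ⟦ not (i ≐ l) ⟧ * f l))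

count-δ-∧ : ∀ {n} (x : Fin n) (p : Fin n → Bool) → count (λ w → x ≐ w ∧ p w) ≡ ⟦ p x ⟧
count-δ-∧ x p = trans (sum-cong-≗ (λ w → ⟦∧⟧ (x ≐ w) (p w))) (∑-δ x (λ w → ⟦ p w ⟧))

count-∧-δ : ∀ {n} (x : Fin n) (p : Fin n → Bool) → count (λ w → p w ∧ w ≐ x) ≡ ⟦ p x ⟧
count-∧-δ x p = trans (sum-cong-≗ (λ w → cong ⟦_⟧ (trans (∧-comm (p w) (w ≐ x)) (cong (_∧ p w) (≐-sym w x)))))
                      (count-δ-∧ x p)

same-by : ∀ {A : Set} (f : A → ℕ) {X X′ a a′} → X ≡ f a → X′ ≡ f a′ → a ≡ a′ → X ≡ X′
same-by f eq eq′ refl = trans eq (sym eq′)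

same-by-cancel : ∀ {A : Set} (h f : A → ℕ) {X X′ a a′} → X + h a ≡ f a → X′ + h a′ ≡ f a′ → a ≡ a′ → X ≡ X′
same-by-cancel h f {X} {X′} {a} eq eq′ refl = +-cancelʳ-≡ (h a) X X′ (trans eq (sym eq′))

agree-from-sum : ∀ {m} (u u′ : Fin (suc m) → ℕ) → sum u ≡ sum u′ →
  (∀ i → u (Fin.suc i) ≡ u′ (Fin.suc i)) → ∀ i → u i ≡ u′ i
agree-from-sum u u′ total rest Fin.zero =
  +-cancelʳ-≡ _ (u Fin.zero) (u′ Fin.zero) (trans total (cong (u′ Fin.zero +_) (sym (sum-cong-≗ rest))))
agree-from-sum u u′ total rest (Fin.suc i) = rest i

-- A finite type enumerated as enum 0, …, enum size, with a sound Boolean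
-- equality; enum 0 serves as a default value in counting arguments.
record Enumerated (A : Set) : Set where
  field
    size        : ℕ
    enum        : Fin (suc size) → A
    _==_        : A → A → Bool
    ==-sound    : ∀ {a c} → (a == c) ≡ true → a ≡ c
    exactly-one : ∀ a → ∑[ i < suc size ] ⟦ a == enum i ⟧ ≡ 1

module Classify {A : Set} (EA : Enumerated A) where
  open Enumerated EA

  ∑-classify : ∀ a (g : A → ℕ) → ∑[ i < suc size ] (⟦ a == enum i ⟧ * g (enum i)) ≡ g a
  ∑-classify a g = begin
    ∑[ i < suc size ] (⟦ a == enum i ⟧ * g (enum i)) ≡⟨ sum-cong-≗ (λ i → at (enum i)) ⟩
    ∑[ i < suc size ] (⟦ a == enum i ⟧ * g a)        ≡⟨ ∑-*ʳ (g a) (λ i → ⟦ a == enum i ⟧) ⟩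
    ∑[ i < suc size ] ⟦ a == enum i ⟧ * g a          ≡⟨ cong (_* g a) (exactly-one a) ⟩
    1 * g a                                           ≡⟨ *-identityˡ (g a) ⟩
    g a                                               ∎
    where
    open ≡-Reasoning
    at : ∀ c → ⟦ a == c ⟧ * g c ≡ ⟦ a == c ⟧ * g a
    at c with a == c in eq
    ... | true  = cong (1 *_) (cong g (sym (==-sound eq)))
    ... | false = refl

  ∑-∧-classify : ∀ p a → ∑[ i < suc size ] ⟦ p ∧ (a == enum i) ⟧ ≡ ⟦ p ⟧
  ∑-∧-classify p a = begin
    ∑[ i < suc size ] ⟦ p ∧ (a == enum i) ⟧         ≡⟨ sum-cong-≗ (λ i → ⟦∧⟧ p (a == enum i)) ⟩
    ∑[ i < suc size ] (⟦ p ⟧ * ⟦ a == enum i ⟧)     ≡⟨ ∑-*ˡ ⟦ p ⟧ (λ i → ⟦ a == enum i ⟧) ⟩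
    ⟦ p ⟧ * ∑[ i < suc size ] ⟦ a == enum i ⟧       ≡⟨ cong (⟦ p ⟧ *_) (exactly-one a) ⟩
    ⟦ p ⟧ * 1                                        ≡⟨ *-identityʳ ⟦ p ⟧ ⟩
    ⟦ p ⟧                                            ∎
    where open ≡-Reasoning

-- The number of z with F (α z) (β z) only depends on the joint distribution of
-- the pair (α, β); that distribution is in turn pinned down by the counts of
-- the non-default values of α, of β, and of the non-default pairs.
module Joint {A B : Set} (EA : Enumerated A) (EB : Enumerated B) where
  open Enumerated EA using () renaming (size to m; enum to a[_]; _==_ to _==ᴬ_)
  open Enumerated EB using () renaming (size to m′; enum to b[_]; _==_ to _==ᴮ_)
  open Enumerated EA using (exactly-one)
  open Classify EA using () renaming (∑-classify to ∑-classifyᴬ)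
  open Classify EB using () renaming (∑-classify to ∑-classifyᴮ; ∑-∧-classify to ∑-∧-classifyᴮ)
  open Classify EA using () renaming (∑-∧-classify to ∑-∧-classifyᴬ)

  module _ {n : ℕ} where

    joint : (Fin n → A) → (Fin n → B) → A → B → ℕ
    joint α β a c = count (λ z → (α z ==ᴬ a) ∧ (β z ==ᴮ c))

    private
      expand : ∀ (F : A → B → Bool) x y →
        ⟦ F x y ⟧ ≡ ∑[ i < suc m ] ∑[ j < suc m′ ] (⟦ F a[ i ] b[ j ] ⟧ * ⟦ (x ==ᴬ a[ i ]) ∧ (y ==ᴮ b[ j ]) ⟧)
      expand F x y = sym (begin
        ∑[ i < suc m ] ∑[ j < suc m′ ] (⟦ F a[ i ] b[ j ] ⟧ * ⟦ (x ==ᴬ a[ i ]) ∧ (y ==ᴮ b[ j ]) ⟧)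
          ≡⟨ sum-cong-≗ (λ i → sum-cong-≗ (λ j → regroup ⟦ F a[ i ] b[ j ] ⟧ (x ==ᴬ a[ i ]) (y ==ᴮ b[ j ]))) ⟩
        ∑[ i < suc m ] ∑[ j < suc m′ ] (⟦ x ==ᴬ a[ i ] ⟧ * (⟦ y ==ᴮ b[ j ] ⟧ * ⟦ F a[ i ] b[ j ] ⟧))
          ≡⟨ sum-cong-≗ (λ i → ∑-*ˡ ⟦ x ==ᴬ a[ i ] ⟧ (λ j → ⟦ y ==ᴮ b[ j ] ⟧ * ⟦ F a[ i ] b[ j ] ⟧)) ⟩
        ∑[ i < suc m ] (⟦ x ==ᴬ a[ i ] ⟧ * ∑[ j < suc m′ ] (⟦ y ==ᴮ b[ j ] ⟧ * ⟦ F a[ i ] b[ j ] ⟧))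
          ≡⟨ sum-cong-≗ (λ i → cong (⟦ x ==ᴬ a[ i ] ⟧ *_) (∑-classifyᴮ y (λ c → ⟦ F a[ i ] c ⟧))) ⟩
        ∑[ i < suc m ] (⟦ x ==ᴬ a[ i ] ⟧ * ⟦ F a[ i ] y ⟧)
          ≡⟨ ∑-classifyᴬ x (λ a → ⟦ F a y ⟧) ⟩
        ⟦ F x y ⟧ ∎)
        where
        open ≡-Reasoning
        regroup : ∀ c p q → c * ⟦ p ∧ q ⟧ ≡ ⟦ p ⟧ * (⟦ q ⟧ * c)
        regroup c p q = trans (cong (c *_) (⟦∧⟧ p q)) (trans (*-comm c (⟦ p ⟧ * ⟦ q ⟧)) (*-assoc ⟦ p ⟧ ⟦ q ⟧ c))

    count-by-joint : ∀ α β (F : A → B → Bool) → count (λ z → F (α z) (β z)) ≡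
      ∑[ i < suc m ] ∑[ j < suc m′ ] (⟦ F a[ i ] b[ j ] ⟧ * joint α β a[ i ] b[ j ])
    count-by-joint α β F = begin
      count (λ z → F (α z) (β z))
        ≡⟨ sum-cong-≗ (λ z → expand F (α z) (β z)) ⟩
      ∑[ z < n ] ∑[ i < suc m ] ∑[ j < suc m′ ] term z i j
        ≡⟨ ∑-comm (λ z i → ∑[ j < suc m′ ] term z i j) ⟩
      ∑[ i < suc m ] ∑[ z < n ] ∑[ j < suc m′ ] term z i j
        ≡⟨ sum-cong-≗ (λ i → ∑-comm (λ z j → term z i j)) ⟩
      ∑[ i < suc m ] ∑[ j < suc m′ ] ∑[ z < n ] term z i j
        ≡⟨ sum-cong-≗ (λ i → sum-cong-≗ (λ j → ∑-*ˡ ⟦ F a[ i ] b[ j ] ⟧ (λ z → ⟦ (α z ==ᴬ a[ i ]) ∧ (β z ==ᴮ b[ j ]) ⟧))) ⟩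
      ∑[ i < suc m ] ∑[ j < suc m′ ] (⟦ F a[ i ] b[ j ] ⟧ * joint α β a[ i ] b[ j ]) ∎
      where
      open ≡-Reasoning
      term : Fin n → Fin (suc m) → Fin (suc m′) → ℕ
      term z i j = ⟦ F a[ i ] b[ j ] ⟧ * ⟦ (α z ==ᴬ a[ i ]) ∧ (β z ==ᴮ b[ j ]) ⟧

    ∑-marginal : ∀ (α : Fin n → A) → ∑[ i < suc m ] count (λ z → α z ==ᴬ a[ i ]) ≡ n
    ∑-marginal α = begin
      ∑[ i < suc m ] ∑[ z < n ] ⟦ α z ==ᴬ a[ i ] ⟧ ≡⟨ ∑-comm (λ i z → ⟦ α z ==ᴬ a[ i ] ⟧) ⟩
      ∑[ z < n ] ∑[ i < suc m ] ⟦ α z ==ᴬ a[ i ] ⟧ ≡⟨ sum-cong-≗ (λ z → exactly-one (α z)) ⟩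
      count {n} (λ _ → true)                       ≡⟨ count-true n ⟩
      n                                            ∎
      where open ≡-Reasoning

    ∑-row : ∀ α β a → ∑[ j < suc m′ ] joint α β a b[ j ] ≡ count (λ z → α z ==ᴬ a)
    ∑-row α β a = begin
      ∑[ j < suc m′ ] ∑[ z < n ] ⟦ (α z ==ᴬ a) ∧ (β z ==ᴮ b[ j ]) ⟧
        ≡⟨ ∑-comm (λ j z → ⟦ (α z ==ᴬ a) ∧ (β z ==ᴮ b[ j ]) ⟧) ⟩
      ∑[ z < n ] ∑[ j < suc m′ ] ⟦ (α z ==ᴬ a) ∧ (β z ==ᴮ b[ j ]) ⟧
        ≡⟨ sum-cong-≗ (λ z → ∑-∧-classifyᴮ (α z ==ᴬ a) (β z)) ⟩
      count (λ z → α z ==ᴬ a) ∎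
      where open ≡-Reasoning

    ∑-column : ∀ α β c → ∑[ i < suc m ] joint α β a[ i ] c ≡ count (λ z → β z ==ᴮ c)
    ∑-column α β c = begin
      ∑[ i < suc m ] ∑[ z < n ] ⟦ (α z ==ᴬ a[ i ]) ∧ (β z ==ᴮ c) ⟧
        ≡⟨ ∑-comm (λ i z → ⟦ (α z ==ᴬ a[ i ]) ∧ (β z ==ᴮ c) ⟧) ⟩
      ∑[ z < n ] ∑[ i < suc m ] ⟦ (α z ==ᴬ a[ i ]) ∧ (β z ==ᴮ c) ⟧
        ≡⟨ sum-cong-≗ (λ z → trans (sum-cong-≗ (λ i → cong ⟦_⟧ (∧-comm (α z ==ᴬ a[ i ]) (β z ==ᴮ c))))
                                   (∑-∧-classifyᴬ (β z ==ᴮ c) (α z))) ⟩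
      count (λ z → β z ==ᴮ c) ∎
      where open ≡-Reasoning

    joint-determined : ∀ (α α′ : Fin n → A) (β β′ : Fin n → B) →
      (∀ i → count (λ z → α z ==ᴬ a[ Fin.suc i ]) ≡ count (λ z → α′ z ==ᴬ a[ Fin.suc i ])) →
      (∀ j → count (λ z → β z ==ᴮ b[ Fin.suc j ]) ≡ count (λ z → β′ z ==ᴮ b[ Fin.suc j ])) →
      (∀ i j → joint α β a[ Fin.suc i ] b[ Fin.suc j ] ≡ joint α′ β′ a[ Fin.suc i ] b[ Fin.suc j ]) →
      ∀ F → count (λ z → F (α z) (β z)) ≡ count (λ z → F (α′ z) (β′ z))
    joint-determined α α′ β β′ same-α same-β same-αβ F = begin
      count (λ z → F (α z) (β z))
        ≡⟨ count-by-joint α β F ⟩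
      ∑[ i < suc m ] ∑[ j < suc m′ ] (⟦ F a[ i ] b[ j ] ⟧ * joint α β a[ i ] b[ j ])
        ≡⟨ sum-cong-≗ (λ i → sum-cong-≗ (λ j → cong (⟦ F a[ i ] b[ j ] ⟧ *_) (all-pairs i j))) ⟩
      ∑[ i < suc m ] ∑[ j < suc m′ ] (⟦ F a[ i ] b[ j ] ⟧ * joint α′ β′ a[ i ] b[ j ])
        ≡⟨ count-by-joint α′ β′ F ⟨
      count (λ z → F (α′ z) (β′ z)) ∎
      where
      open ≡-Reasoning
      all-α : ∀ i → count (λ z → α z ==ᴬ a[ i ]) ≡ count (λ z → α′ z ==ᴬ a[ i ])
      all-α = agree-from-sum _ _ (trans (∑-marginal α) (sym (∑-marginal α′))) same-α
      columns : ∀ j i → joint α β a[ i ] b[ Fin.suc j ] ≡ joint α′ β′ a[ i ] b[ Fin.suc j ]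
      columns j = agree-from-sum _ _
        (trans (∑-column α β _) (trans (same-β j) (sym (∑-column α′ β′ _)))) (λ i → same-αβ i j)
      all-pairs : ∀ i j → joint α β a[ i ] b[ j ] ≡ joint α′ β′ a[ i ] b[ j ]
      all-pairs i = agree-from-sum _ _
        (trans (∑-row α β _) (trans (all-α i) (sym (∑-row α′ β′ _)))) (λ j → columns j i)

all-cong : ∀ {A : Set} {f g : A → Bool} → (∀ x → f x ≡ g x) → ∀ xs → all f xs ≡ all g xs
all-cong f≗g xs = cong and (map-cong f≗g xs)

all-true : ∀ {A : Set} {f : A → Bool} → (∀ x → f x ≡ true) → ∀ xs → all f xs ≡ true
all-true f≡true []       = refl
all-true f≡true (x ∷ xs) rewrite f≡true x = all-true f≡true xs

any-true : ∀ {A : Set} {f : A → Bool} {x xs} → x ∈ xs → f x ≡ true → any f xs ≡ true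
any-true {xs = y ∷ ys} (here refl) fx rewrite fx = refl
any-true {f = f} {xs = y ∷ ys} (there x∈ys) fx with f y
... | true  = refl
... | false = any-true x∈ys fx

any-false : ∀ {A : Set} {f : A → Bool} → (∀ x → f x ≡ false) → ∀ xs → any f xs ≡ false
any-false f≡false []       = refl
any-false f≡false (x ∷ xs) rewrite f≡false x = any-false f≡false xs

factor-through : ∀ {X C : Set} (xs : List X) → (∀ w → w ∈ xs) →
  (cls : X → C) → DecidableEquality C → (g : X → Bool) →
  (∀ w w′ → cls w ≡ cls w′ → g w ≡ g w′) →
  Σ[ ĝ ∈ (C → Bool) ] (∀ w → ĝ (cls w) ≡ g w)
factor-through xs every cls _≟_ g invariant = ĝ , correct
  where
  ĝ : _ → Bool
  ĝ c = any (λ w → does (cls w ≟ c) ∧ g w) xs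
  correct : ∀ w → ĝ (cls w) ≡ g w
  correct w with g w in gw
  ... | true  = any-true (every w) (cong₂ _∧_ (dec-true (cls w ≟ cls w) refl) gw)
  ... | false = any-false other xs
    where
    other : ∀ w′ → does (cls w′ ≟ cls w) ∧ g w′ ≡ false
    other w′ with cls w′ ≟ cls w
    ... | yes same = trans (invariant w′ w same) gw
    ... | no _     = refl

≡ᵇ-refl : ∀ m → (m ≡ᵇ m) ≡ true
≡ᵇ-refl zero    = refl
≡ᵇ-refl (suc m) = ≡ᵇ-refl m

==₀-refl : ∀ c → (c ==₀ c) ≡ true
==₀-refl vertex   = refl
==₀-refl edge     = refl
==₀-refl non-edge = refl

module Refinement (n : ℕ) (adj : Fin n → Fin n → Bool) where
  open WL n adj

  -- A classification of the pairs of vertices that refines the initial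
  -- colouring and for which the number of z with (x , z) in class c and
  -- (z , y) in class d depends only on the class of (x , y) (a coherent
  -- configuration); the condition is stated for every Boolean combination F.
  record Coherent {C : Set} (cls : Pair → C) : Set where
    field
      _≟ᶜ_         : DecidableEquality C
      initial      : ∀ p q → cls p ≡ cls q → c₀ p ≡ c₀ q
      intersection : ∀ (F : C → C → Bool) x y x′ y′ → cls (x , y) ≡ cls (x′ , y′) →
        count (λ z → F (cls (x , z)) (cls (z , y))) ≡ count (λ z → F (cls (x′ , z)) (cls (z , y′)))

  sameColour-refl : ∀ j p → sameColour j p p ≡ true
  sameColour-refl zero    p = ==₀-refl (c₀ p)
  sameColour-refl (suc j) p = cong₂ _∧_ (sameColour-refl j p)
    (all-true (λ r → all-true (λ s → ≡ᵇ-refl (mult j p r s)) pairs) pairs)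

  pairs-complete : ∀ w → w ∈ pairs
  pairs-complete (x , y) = ∈-cartesianProduct⁺ (∈-allFin x) (∈-allFin y)

  module _ {C : Set} {cls : Pair → C} (coherent : Coherent cls) where
    open Coherent coherent

    respects : ∀ j p q r → cls p ≡ cls q → sameColour j p r ≡ sameColour j q r
    mult-respects : ∀ j x y x′ y′ r s → cls (x , y) ≡ cls (x′ , y′) →
      mult j (x , y) r s ≡ mult j (x′ , y′) r s

    respects zero    p q r same = cong (_==₀ c₀ r) (initial p q same)
    respects (suc j) p q r same = cong₂ _∧_ (respects j p q r same)
      (all-cong (λ r′ → all-cong (λ s′ → cong (_≡ᵇ mult j r r′ s′)
        (mult-respects j _ _ _ _ r′ s′ same)) pairs) pairs)

    mult-respects j x y x′ y′ r s same = begin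
      mult j (x , y) r s
        ≡⟨ length-filter-allFin (λ z → sameColour j (x , z) r ∧ sameColour j (z , y) s) ⟩
      count (λ z → sameColour j (x , z) r ∧ sameColour j (z , y) s)
        ≡⟨ sum-cong-≗ (λ z → cong ⟦_⟧ (cong₂ _∧_ (sym (proj₂ ĝ (x , z))) (sym (proj₂ ĥ (z , y))))) ⟩
      count (λ z → F (cls (x , z)) (cls (z , y)))
        ≡⟨ intersection F x y x′ y′ same ⟩
      count (λ z → F (cls (x′ , z)) (cls (z , y′)))
        ≡⟨ sum-cong-≗ (λ z → cong ⟦_⟧ (cong₂ _∧_ (proj₂ ĝ (x′ , z)) (proj₂ ĥ (z , y′)))) ⟩
      count (λ z → sameColour j (x′ , z) r ∧ sameColour j (z , y′) s)
        ≡⟨ length-filter-allFin (λ z → sameColour j (x′ , z) r ∧ sameColour j (z , y′) s) ⟨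
      mult j (x′ , y′) r s ∎
      where
      open ≡-Reasoning
      ĝ = factor-through pairs pairs-complete cls _≟ᶜ_ (λ w → sameColour j w r) (λ w w′ → respects j w w′ r)
      ĥ = factor-through pairs pairs-complete cls _≟ᶜ_ (λ w → sameColour j w s) (λ w w′ → respects j w w′ s)
      F : C → C → Bool
      F c d = proj₁ ĝ c ∧ proj₁ ĥ d

    stable-refines : ∀ j p q → cls p ≡ cls q → sameColour j p q ≡ true
    stable-refines j p q same = trans (respects j p q q same) (sameColour-refl j q)

∣∣-count : ∀ {n} (p : Subset n) → ∣ p ∣ ≡ count (λ w → does (w ∈? p))
∣∣-count []            = refl
∣∣-count (inside ∷ p)  = cong suc (∣∣-count p)
∣∣-count (outside ∷ p) = ∣∣-count p

-- In a design with blocks of size k ≥ 2, the equation a (k − 1) = v − 1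
-- for the replication number a has at most one solution.
replication-unique : ∀ {v k} → 2 ≤ k → ∀ a a′ → a * k + 1 ≡ v + a → a′ * k + 1 ≡ v + a′ → a ≡ a′
replication-unique {k = suc zero} (s≤s ())
replication-unique {v} {suc (suc k′)} _ a a′ eq eq′ =
  *-cancelʳ-≡ a a′ (suc k′) (+-cancelʳ-≡ 1 _ _ (trans (reduce a eq) (sym (reduce a′ eq′))))
  where
  reduce : ∀ c → c * suc (suc k′) + 1 ≡ v + c → c * suc k′ + 1 ≡ v
  reduce c eq = +-cancelʳ-≡ c _ _ (trans (solve 2 (λ c k′ → c :* (con 1 :+ k′) :+ con 1 :+ c := c :* (con 2 :+ k′) :+ con 1) refl c k′) eq)

n*n≡n⇒n≤1 : ∀ n → n * n ≡ n → n ≤ 1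
n*n≡n⇒n≤1 zero          _  = z≤n
n*n≡n⇒n≤1 (suc zero)    _  = s≤s z≤n
n*n≡n⇒n≤1 (suc (suc n)) eq with +-cancelˡ-≡ (suc (suc n)) (suc n * suc (suc n)) 0 (trans eq (sym (+-identityʳ _)))
... | ()

sum≤1⇒product≡0 : ∀ a c → a + c ≤ 1 → a * c ≡ 0
sum≤1⇒product≡0 zero    c       _           = refl
sum≤1⇒product≡0 (suc a) zero    _           = *-zeroʳ (suc a)
sum≤1⇒product≡0 (suc a) (suc c) (s≤s a+c≤0) with subst (_≤ 0) (+-suc a c) a+c≤0
... | ()

data BlockRel : Set where
  identical intersecting disjoint : BlockRel

_≟ᴿ_ : DecidableEquality BlockRel
identical    ≟ᴿ identical    = yes refl
identical    ≟ᴿ intersecting = no λ ()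
identical    ≟ᴿ disjoint     = no λ ()
intersecting ≟ᴿ identical    = no λ ()
intersecting ≟ᴿ intersecting = yes refl
intersecting ≟ᴿ disjoint     = no λ ()
disjoint     ≟ᴿ identical    = no λ ()
disjoint     ≟ᴿ intersecting = no λ ()
disjoint     ≟ᴿ disjoint     = yes refl

_==ᴿ_ : BlockRel → BlockRel → Bool
s ==ᴿ t = does (s ≟ᴿ t)

relate : Bool → ℕ → BlockRel
relate true  _       = identical
relate false zero    = disjoint
relate false (suc _) = intersecting

relate-identical : ∀ c n → (relate c n ==ᴿ identical) ≡ c
relate-identical true  n       = refl
relate-identical false zero    = refl
relate-identical false (suc n) = refl

module Steiner (v k b : ℕ) (B : Fin b → Subset v) (bibd : IsBIBD v k 1 b B) where
  open IsBIBD bibd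
  open ≡-Reasoning

  _∈ᴮ_ : Fin v → Fin b → Bool
  x ∈ᴮ i = does (x ∈? B i)

  block-size : ∀ i → count (_∈ᴮ i) ≡ k
  block-size i = trans (sym (∣∣-count (B i))) (blockSize i)

  r : Fin v → ℕ
  r x = count (x ∈ᴮ_)

  through : Fin v → Fin v → ℕ
  through x y = count (λ l → x ∈ᴮ l ∧ y ∈ᴮ l)

  through-if : ∀ x y → through x y ≡ (if x ≐ y then r x else 1)
  through-if x y with x ≟ y
  ... | yes refl = sum-cong-≗ (λ l → cong ⟦_⟧ (∧-idem (x ∈ᴮ l)))
  ... | no x≢y   = trans (sym (length-filter-allFin (λ l → x ∈ᴮ l ∧ y ∈ᴮ l))) (balanced x y x≢y)

  through-δ : ∀ x y → through x y + ⟦ x ≐ y ⟧ ≡ 1 + ⟦ x ≐ y ⟧ * r x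
  through-δ x y rewrite through-if x y with x ≐ y
  ... | true  = trans (+-comm (r x) 1) (cong suc (sym (+-identityʳ (r x))))
  ... | false = refl

  -- Double counting the flags (w, l) with x, w ∈ l.
  ∑-through : ∀ x → ∑[ w < v ] through x w ≡ r x * k
  ∑-through x = begin
    ∑[ w < v ] ∑[ l < b ] ⟦ x ∈ᴮ l ∧ w ∈ᴮ l ⟧       ≡⟨ ∑-comm (λ w l → ⟦ x ∈ᴮ l ∧ w ∈ᴮ l ⟧) ⟩
    ∑[ l < b ] ∑[ w < v ] ⟦ x ∈ᴮ l ∧ w ∈ᴮ l ⟧       ≡⟨ sum-cong-≗ (λ l → sum-cong-≗ (λ w → ⟦∧⟧ (x ∈ᴮ l) (w ∈ᴮ l))) ⟩
    ∑[ l < b ] ∑[ w < v ] (⟦ x ∈ᴮ l ⟧ * ⟦ w ∈ᴮ l ⟧) ≡⟨ sum-cong-≗ (λ l → ∑-*ˡ ⟦ x ∈ᴮ l ⟧ (λ w → ⟦ w ∈ᴮ l ⟧)) ⟩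
    ∑[ l < b ] (⟦ x ∈ᴮ l ⟧ * count (_∈ᴮ l))        ≡⟨ sum-cong-≗ (λ l → cong (⟦ x ∈ᴮ l ⟧ *_) (block-size l)) ⟩
    ∑[ l < b ] (⟦ x ∈ᴮ l ⟧ * k)                    ≡⟨ ∑-*ʳ k (λ l → ⟦ x ∈ᴮ l ⟧) ⟩
    r x * k                                         ∎

  -- r x (k − 1) = v − 1, in additive form.
  replication-equation : ∀ x → r x * k + 1 ≡ v + r x
  replication-equation x = begin
    r x * k + 1                                         ≡⟨ cong₂ _+_ (∑-through x) (count-δ x) ⟨
    ∑[ w < v ] through x w + count (x ≐_)               ≡⟨ ∑-distrib-+ (through x) (λ w → ⟦ x ≐ w ⟧) ⟨
    ∑[ w < v ] (through x w + ⟦ x ≐ w ⟧)                ≡⟨ sum-cong-≗ (through-δ x) ⟩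
    ∑[ w < v ] (1 + ⟦ x ≐ w ⟧ * r x)                    ≡⟨ ∑-distrib-+ (λ _ → 1) (λ w → ⟦ x ≐ w ⟧ * r x) ⟩
    count {v} (λ _ → true) + ∑[ w < v ] (⟦ x ≐ w ⟧ * r x) ≡⟨ cong₂ _+_ (count-true v) (∑-δ x (λ _ → r x)) ⟩
    v + r x                                             ∎

  point₀ : Fin v
  point₀ = fromℕ< (≤-trans (s≤s z≤n) k<v)

  r₀ : ℕ
  r₀ = r point₀

  replication : ∀ x → r x ≡ r₀
  replication x = replication-unique k>1 (r x) r₀ (replication-equation x) (replication-equation point₀)

  through-r₀ : ∀ x y → through x y ≡ (if x ≐ y then r₀ else 1)
  through-r₀ x y with x ≐ y | through-if x y
  ... | true  | eq = trans eq (replication x)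
  ... | false | eq = eq

  through-δ₀ : ∀ x y → through x y + ⟦ x ≐ y ⟧ ≡ 1 + ⟦ x ≐ y ⟧ * r₀
  through-δ₀ x y = trans (through-δ x y) (cong (λ c → 1 + ⟦ x ≐ y ⟧ * c) (replication x))

  weight : (Fin v → ℕ) → Fin b → ℕ
  weight f l = ∑[ w < v ] (⟦ w ∈ᴮ l ⟧ * f w)

  -- Each point is counted in r₀ blocks.
  ∑-weight : ∀ f → ∑[ l < b ] weight f l ≡ sum f * r₀
  ∑-weight f = begin
    ∑[ l < b ] ∑[ w < v ] (⟦ w ∈ᴮ l ⟧ * f w) ≡⟨ ∑-comm (λ l w → ⟦ w ∈ᴮ l ⟧ * f w) ⟩
    ∑[ w < v ] ∑[ l < b ] (⟦ w ∈ᴮ l ⟧ * f w) ≡⟨ sum-cong-≗ (λ w → ∑-*ʳ (f w) (λ l → ⟦ w ∈ᴮ l ⟧)) ⟩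
    ∑[ w < v ] (r w * f w)                   ≡⟨ sum-cong-≗ (λ w → trans (cong (_* f w) (replication w)) (*-comm r₀ (f w))) ⟩
    ∑[ w < v ] (f w * r₀)                    ≡⟨ ∑-*ʳ r₀ f ⟩
    sum f * r₀                               ∎

  -- The flag count behind the identity N Nᵀ = (r₀ − 1) I + J for the incidence
  -- matrix N, tested against weights f and g (in additive form).
  incidence-identity : ∀ f g →
    ∑[ l < b ] (weight f l * weight g l) + ∑[ w < v ] (f w * g w) ≡
    sum f * sum g + ∑[ w < v ] (f w * g w) * r₀
  incidence-identity f g = begin
    ∑[ l < b ] (weight f l * weight g l) + ∑[ w < v ] (f w * g w)
      ≡⟨ cong₂ _+_ flags (sum-cong-≗ (λ w → sym (∑-δ w (λ w′ → f w * g w′)))) ⟩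
    ∑∑ (λ w w′ → P w w′ * through w w′) + ∑∑ (λ w w′ → ⟦ w ≐ w′ ⟧ * P w w′)
      ≡⟨ ∑∑-distrib-+ (λ w w′ → P w w′ * through w w′) (λ w w′ → ⟦ w ≐ w′ ⟧ * P w w′) ⟨
    ∑∑ (λ w w′ → P w w′ * through w w′ + ⟦ w ≐ w′ ⟧ * P w w′)
      ≡⟨ sum-cong-≗ (λ w → sum-cong-≗ (λ w′ → regroup (P w w′) (through w w′) ⟦ w ≐ w′ ⟧ (through-δ₀ w w′))) ⟩
    ∑∑ (λ w w′ → P w w′ + ⟦ w ≐ w′ ⟧ * (P w w′ * r₀))
      ≡⟨ ∑∑-distrib-+ P (λ w w′ → ⟦ w ≐ w′ ⟧ * (P w w′ * r₀)) ⟩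
    ∑∑ P + ∑∑ (λ w w′ → ⟦ w ≐ w′ ⟧ * (P w w′ * r₀))
      ≡⟨ cong₂ _+_ product (sum-cong-≗ (λ w → ∑-δ w (λ w′ → P w w′ * r₀))) ⟩
    sum f * sum g + ∑[ w < v ] (f w * g w * r₀)
      ≡⟨ cong (sum f * sum g +_) (∑-*ʳ r₀ (λ w → f w * g w)) ⟩
    sum f * sum g + ∑[ w < v ] (f w * g w) * r₀ ∎
    where
    P : Fin v → Fin v → ℕ
    P w w′ = f w * g w′

    ∑∑ : (Fin v → Fin v → ℕ) → ℕ
    ∑∑ h = ∑[ w < v ] ∑[ w′ < v ] h w w′

    ∑∑-distrib-+ : ∀ h h′ → ∑∑ (λ w w′ → h w w′ + h′ w w′) ≡ ∑∑ h + ∑∑ h′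
    ∑∑-distrib-+ h h′ = trans (sum-cong-≗ (λ w → ∑-distrib-+ (h w) (h′ w))) (∑-distrib-+ (λ w → sum (h w)) (λ w → sum (h′ w)))

    regroup : ∀ p t d → t + d ≡ 1 + d * r₀ → p * t + d * p ≡ p + d * (p * r₀)
    regroup p t d eq = begin
      p * t + d * p      ≡⟨ cong (p * t +_) (*-comm d p) ⟩
      p * t + p * d      ≡⟨ *-distribˡ-+ p t d ⟨
      p * (t + d)        ≡⟨ cong (p *_) eq ⟩
      p * (1 + d * r₀)   ≡⟨ solve 3 (λ p d r → p :* (con 1 :+ d :* r) := p :+ d :* (p :* r)) refl p d r₀ ⟩
      p + d * (p * r₀)   ∎

    flags : ∑[ l < b ] (weight f l * weight g l) ≡ ∑∑ (λ w w′ → P w w′ * through w w′)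
    flags = begin
      ∑[ l < b ] (weight f l * weight g l)
        ≡⟨ sum-cong-≗ (λ l → trans (sym (∑-*ʳ (weight g l) (λ w → ⟦ w ∈ᴮ l ⟧ * f w)))
                                   (sum-cong-≗ (λ w → sym (∑-*ˡ (⟦ w ∈ᴮ l ⟧ * f w) (λ w′ → ⟦ w′ ∈ᴮ l ⟧ * g w′))))) ⟩
      ∑[ l < b ] ∑[ w < v ] ∑[ w′ < v ] Q l w w′
        ≡⟨ ∑-comm (λ l w → ∑[ w′ < v ] Q l w w′) ⟩
      ∑[ w < v ] ∑[ l < b ] ∑[ w′ < v ] Q l w w′
        ≡⟨ sum-cong-≗ (λ w → ∑-comm (λ l w′ → Q l w w′)) ⟩
      ∑[ w < v ] ∑[ w′ < v ] ∑[ l < b ] Q l w w′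
        ≡⟨ sum-cong-≗ (λ w → sum-cong-≗ (λ w′ → trans (sum-cong-≗ (λ l → Q-flag l w w′))
                                                        (∑-*ˡ (P w w′) (λ l → ⟦ w ∈ᴮ l ∧ w′ ∈ᴮ l ⟧)))) ⟩
      ∑∑ (λ w w′ → P w w′ * through w w′) ∎
      where
      Q : Fin b → Fin v → Fin v → ℕ
      Q l w w′ = ⟦ w ∈ᴮ l ⟧ * f w * (⟦ w′ ∈ᴮ l ⟧ * g w′)
      Q-flag : ∀ l w w′ → Q l w w′ ≡ P w w′ * ⟦ w ∈ᴮ l ∧ w′ ∈ᴮ l ⟧
      Q-flag l w w′ = trans (solve 4 (λ a x c y → a :* x :* (c :* y) := x :* y :* (a :* c)) refl ⟦ w ∈ᴮ l ⟧ (f w) ⟦ w′ ∈ᴮ l ⟧ (g w′))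
                            (cong (P w w′ *_) (sym (⟦∧⟧ (w ∈ᴮ l) (w′ ∈ᴮ l))))

    product : ∑∑ P ≡ sum f * sum g
    product = begin
      ∑[ w < v ] ∑[ w′ < v ] (f w * g w′) ≡⟨ sum-cong-≗ (λ w → ∑-*ˡ (f w) g) ⟩
      ∑[ w < v ] (f w * sum g)           ≡⟨ ∑-*ʳ (sum g) f ⟩
      sum f * sum g                      ∎

  meet : Fin b → Fin b → ℕ
  meet i j = count (λ w → w ∈ᴮ i ∧ w ∈ᴮ j)

  meet-sym : ∀ i j → meet i j ≡ meet j i
  meet-sym i j = sum-cong-≗ (λ w → cong ⟦_⟧ (∧-comm (w ∈ᴮ i) (w ∈ᴮ j)))

  meet-self : ∀ i → meet i i ≡ k
  meet-self i = trans (sum-cong-≗ (λ w → cong ⟦_⟧ (∧-idem (w ∈ᴮ i)))) (block-size i)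

  weight-of-block : ∀ j l → weight (λ w → ⟦ w ∈ᴮ j ⟧) l ≡ meet l j
  weight-of-block j l = sum-cong-≗ (λ w → sym (⟦∧⟧ (w ∈ᴮ l) (w ∈ᴮ j)))

  -- Two distinct blocks share at most one point, since two points lie on
  -- only one block: the square of the meet counts ordered pairs of common
  -- points, and only the diagonal ones contribute.
  meet≤1 : ∀ i j → i ≢ j → meet i j ≤ 1
  meet≤1 i j i≢j = n*n≡n⇒n≤1 (meet i j) square
    where
    g : Fin v → ℕ
    g w = ⟦ w ∈ᴮ i ∧ w ∈ᴮ j ⟧

    off-diagonal : ∀ w w′ → ⟦ not (w ≐ w′) ⟧ * (g w * g w′) ≡ 0
    off-diagonal w w′ with w ≟ w′
    ... | yes _   = refl
    ... | no w≢w′ = trans (+-identityʳ (g w * g w′)) (trans regroup (sum≤1⇒product≡0 ⟦ w ∈ᴮ i ∧ w′ ∈ᴮ i ⟧ ⟦ w ∈ᴮ j ∧ w′ ∈ᴮ j ⟧ two-blocks))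
      where
      regroup : g w * g w′ ≡ ⟦ w ∈ᴮ i ∧ w′ ∈ᴮ i ⟧ * ⟦ w ∈ᴮ j ∧ w′ ∈ᴮ j ⟧
      regroup = begin
        g w * g w′ ≡⟨ cong₂ _*_ (⟦∧⟧ (w ∈ᴮ i) (w ∈ᴮ j)) (⟦∧⟧ (w′ ∈ᴮ i) (w′ ∈ᴮ j)) ⟩
        ⟦ w ∈ᴮ i ⟧ * ⟦ w ∈ᴮ j ⟧ * (⟦ w′ ∈ᴮ i ⟧ * ⟦ w′ ∈ᴮ j ⟧)
          ≡⟨ solve 4 (λ a c a′ c′ → a :* c :* (a′ :* c′) := a :* a′ :* (c :* c′)) refl ⟦ w ∈ᴮ i ⟧ ⟦ w ∈ᴮ j ⟧ ⟦ w′ ∈ᴮ i ⟧ ⟦ w′ ∈ᴮ j ⟧ ⟩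
        ⟦ w ∈ᴮ i ⟧ * ⟦ w′ ∈ᴮ i ⟧ * (⟦ w ∈ᴮ j ⟧ * ⟦ w′ ∈ᴮ j ⟧)
          ≡⟨ cong₂ _*_ (⟦∧⟧ (w ∈ᴮ i) (w′ ∈ᴮ i)) (⟦∧⟧ (w ∈ᴮ j) (w′ ∈ᴮ j)) ⟨
        ⟦ w ∈ᴮ i ∧ w′ ∈ᴮ i ⟧ * ⟦ w ∈ᴮ j ∧ w′ ∈ᴮ j ⟧ ∎
      two-blocks : ⟦ w ∈ᴮ i ∧ w′ ∈ᴮ i ⟧ + ⟦ w ∈ᴮ j ∧ w′ ∈ᴮ j ⟧ ≤ 1
      two-blocks = subst (⟦ w ∈ᴮ i ∧ w′ ∈ᴮ i ⟧ + ⟦ w ∈ᴮ j ∧ w′ ∈ᴮ j ⟧ ≤_) (trans (sym (length-filter-allFin (λ l → w ∈ᴮ l ∧ w′ ∈ᴮ l))) (balanced w w′ w≢w′))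
                         (two-terms≤sum i j i≢j (λ l → ⟦ w ∈ᴮ l ∧ w′ ∈ᴮ l ⟧))

    square : meet i j * meet i j ≡ meet i j
    square = begin
      meet i j * meet i j                        ≡⟨ ∑-*ʳ (meet i j) g ⟨
      ∑[ w < v ] (g w * meet i j)                ≡⟨ sum-cong-≗ (λ w → sym (∑-*ˡ (g w) g)) ⟩
      ∑[ w < v ] ∑[ w′ < v ] (g w * g w′)        ≡⟨ sum-cong-≗ (λ w → ∑-isolate w (λ w′ → g w * g w′)) ⟩
      ∑[ w < v ] (g w * g w + ∑[ w′ < v ] (⟦ not (w ≐ w′) ⟧ * (g w * g w′)))
        ≡⟨ sum-cong-≗ (λ w → cong₂ _+_ (⟦⟧-idem (w ∈ᴮ i ∧ w ∈ᴮ j)) (trans (sum-cong-≗ (off-diagonal w)) (sum-replicate-zero v))) ⟩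
      ∑[ w < v ] (g w + 0)                       ≡⟨ sum-cong-≗ (λ w → +-identityʳ (g w)) ⟩
      meet i j                                   ∎

  rel : Fin b → Fin b → BlockRel
  rel i j = relate (i ≐ j) (meet i j)

  rel-identical : ∀ l j → (rel l j ==ᴿ identical) ≡ (l ≐ j)
  rel-identical l j = relate-identical (l ≐ j) (meet l j)

  rel-sym : ∀ i j → rel i j ≡ rel j i
  rel-sym i j = cong₂ relate (≐-sym i j) (meet-sym i j)

  common : BlockRel → ℕ
  common identical    = k
  common intersecting = 1
  common disjoint     = 0

  meet-common : ∀ i j → meet i j ≡ common (rel i j)
  meet-common i j with i ≟ j
  ... | yes refl = meet-self i
  ... | no i≢j   = at-most-one (meet i j) (meet≤1 i j i≢j)
    where
    at-most-one : ∀ n → n ≤ 1 → n ≡ common (relate false n)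
    at-most-one zero          _         = refl
    at-most-one (suc zero)    _         = refl
    at-most-one (suc (suc n)) (s≤s ())

  meet-decomposition : ∀ l j → meet l j ≡ ⟦ j ≐ l ⟧ * k + ⟦ rel l j ==ᴿ intersecting ⟧
  meet-decomposition l j = begin
    meet l j                                                        ≡⟨ meet-common l j ⟩
    common (rel l j)                                               ≡⟨ by-cases (rel l j) ⟩
    ⟦ rel l j ==ᴿ identical ⟧ * k + ⟦ rel l j ==ᴿ intersecting ⟧ ≡⟨ cong (λ c → ⟦ c ⟧ * k + ⟦ rel l j ==ᴿ intersecting ⟧) (rel-identical l j) ⟩
    ⟦ l ≐ j ⟧ * k + ⟦ rel l j ==ᴿ intersecting ⟧                 ≡⟨ cong (λ c → ⟦ c ⟧ * k + ⟦ rel l j ==ᴿ intersecting ⟧) (≐-sym l j) ⟩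
    ⟦ j ≐ l ⟧ * k + ⟦ rel l j ==ᴿ intersecting ⟧                 ∎
    where
    by-cases : ∀ t → common t ≡ ⟦ t ==ᴿ identical ⟧ * k + ⟦ t ==ᴿ intersecting ⟧
    by-cases identical    = sym (trans (+-identityʳ _) (+-identityʳ k))
    by-cases intersecting = refl
    by-cases disjoint     = refl

  meeting-blocks : ∀ j → count (λ l → rel l j ==ᴿ intersecting) + k ≡ k * r₀
  meeting-blocks j = begin
    count (λ l → rel l j ==ᴿ intersecting) + k
      ≡⟨ +-comm (count (λ l → rel l j ==ᴿ intersecting)) k ⟩
    k + count (λ l → rel l j ==ᴿ intersecting)
      ≡⟨ cong (_+ count (λ l → rel l j ==ᴿ intersecting)) (∑-δ j (λ _ → k)) ⟨
    ∑[ l < b ] (⟦ j ≐ l ⟧ * k) + count (λ l → rel l j ==ᴿ intersecting)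
      ≡⟨ ∑-distrib-+ (λ l → ⟦ j ≐ l ⟧ * k) (λ l → ⟦ rel l j ==ᴿ intersecting ⟧) ⟨
    ∑[ l < b ] (⟦ j ≐ l ⟧ * k + ⟦ rel l j ==ᴿ intersecting ⟧)
      ≡⟨ sum-cong-≗ (λ l → trans (weight-of-block j l) (meet-decomposition l j)) ⟨
    ∑[ l < b ] weight (λ w → ⟦ w ∈ᴮ j ⟧) l
      ≡⟨ ∑-weight (λ w → ⟦ w ∈ᴮ j ⟧) ⟩
    count (_∈ᴮ j) * r₀
      ≡⟨ cong (_* r₀) (block-size j) ⟩
    k * r₀ ∎

  meeting-blocks-through : ∀ x j →
    count (λ l → x ∈ᴮ l ∧ rel l j ==ᴿ intersecting) + (⟦ x ∈ᴮ j ⟧ * k + ⟦ x ∈ᴮ j ⟧) ≡ k + ⟦ x ∈ᴮ j ⟧ * r₀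
  meeting-blocks-through x j = begin
    X + (m * k + m)                                 ≡⟨ solve 3 (λ X a m → X :+ (a :+ m) := a :+ X :+ m) refl X (m * k) m ⟩
    m * k + X + m                                   ≡⟨ cong₂ _+_ lines-through-x (∑-δ x χ) ⟨
    ∑[ l < b ] (weight δ l * weight χ l) + ∑[ w < v ] (δ w * χ w)
                                                    ≡⟨ incidence-identity δ χ ⟩
    sum δ * sum χ + ∑[ w < v ] (δ w * χ w) * r₀     ≡⟨ cong₂ (λ a c → a * sum χ + c * r₀) (count-δ x) (∑-δ x χ) ⟩
    1 * sum χ + m * r₀                              ≡⟨ cong (_+ m * r₀) (trans (*-identityˡ (sum χ)) (block-size j)) ⟩
    k + m * r₀                                      ∎
    where
    X = count (λ l → x ∈ᴮ l ∧ rel l j ==ᴿ intersecting)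
    m = ⟦ x ∈ᴮ j ⟧
    δ χ : Fin v → ℕ
    δ w = ⟦ x ≐ w ⟧
    χ w = ⟦ w ∈ᴮ j ⟧

    weight-δ : ∀ l → weight δ l ≡ ⟦ x ∈ᴮ l ⟧
    weight-δ l = trans (sum-cong-≗ (λ w → *-comm ⟦ w ∈ᴮ l ⟧ (δ w))) (∑-δ x (λ w → ⟦ w ∈ᴮ l ⟧))

    split : ∀ l → ⟦ x ∈ᴮ l ⟧ * meet l j ≡ ⟦ j ≐ l ⟧ * (⟦ x ∈ᴮ l ⟧ * k) + ⟦ x ∈ᴮ l ∧ rel l j ==ᴿ intersecting ⟧
    split l = begin
      ⟦ x ∈ᴮ l ⟧ * meet l j
        ≡⟨ cong (⟦ x ∈ᴮ l ⟧ *_) (meet-decomposition l j) ⟩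
      ⟦ x ∈ᴮ l ⟧ * (⟦ j ≐ l ⟧ * k + ⟦ rel l j ==ᴿ intersecting ⟧)
        ≡⟨ solve 4 (λ a d k I → a :* (d :* k :+ I) := d :* (a :* k) :+ a :* I) refl ⟦ x ∈ᴮ l ⟧ ⟦ j ≐ l ⟧ k ⟦ rel l j ==ᴿ intersecting ⟧ ⟩
      ⟦ j ≐ l ⟧ * (⟦ x ∈ᴮ l ⟧ * k) + ⟦ x ∈ᴮ l ⟧ * ⟦ rel l j ==ᴿ intersecting ⟧
        ≡⟨ cong (⟦ j ≐ l ⟧ * (⟦ x ∈ᴮ l ⟧ * k) +_) (⟦∧⟧ (x ∈ᴮ l) (rel l j ==ᴿ intersecting)) ⟨
      ⟦ j ≐ l ⟧ * (⟦ x ∈ᴮ l ⟧ * k) + ⟦ x ∈ᴮ l ∧ rel l j ==ᴿ intersecting ⟧ ∎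

    lines-through-x : ∑[ l < b ] (weight δ l * weight χ l) ≡ m * k + X
    lines-through-x = begin
      ∑[ l < b ] (weight δ l * weight χ l)
        ≡⟨ sum-cong-≗ (λ l → trans (cong₂ _*_ (weight-δ l) (weight-of-block j l)) (split l)) ⟩
      ∑[ l < b ] (⟦ j ≐ l ⟧ * (⟦ x ∈ᴮ l ⟧ * k) + ⟦ x ∈ᴮ l ∧ rel l j ==ᴿ intersecting ⟧)
        ≡⟨ ∑-distrib-+ (λ l → ⟦ j ≐ l ⟧ * (⟦ x ∈ᴮ l ⟧ * k)) (λ l → ⟦ x ∈ᴮ l ∧ rel l j ==ᴿ intersecting ⟧) ⟩
      ∑[ l < b ] (⟦ j ≐ l ⟧ * (⟦ x ∈ᴮ l ⟧ * k)) + X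
        ≡⟨ cong (_+ X) (∑-δ j (λ l → ⟦ x ∈ᴮ l ⟧ * k)) ⟩
      m * k + X ∎

  -- The blocks meeting both i and j (other than i and j), counted through
  -- the products of intersection sizes.
  meeting-both : ∀ i j →
    count (λ l → rel i l ==ᴿ intersecting ∧ rel l j ==ᴿ intersecting)
      + (k * meet i j + ⟦ rel i j ==ᴿ intersecting ⟧ * k + meet i j)
    ≡ k * k + meet i j * r₀
  meeting-both i j = begin
    X + (k * M + C * k + M)                          ≡⟨ solve 4 (λ X a c m → X :+ (a :+ c :+ m) := a :+ (c :+ X) :+ m) refl X (k * M) (C * k) M ⟩
    k * M + (C * k + X) + M                          ≡⟨ cong₂ _+_ products (∑-χχ) ⟨
    ∑[ l < b ] (weight χᵢ l * weight χⱼ l) + ∑[ w < v ] (χᵢ w * χⱼ w)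
                                                     ≡⟨ incidence-identity χᵢ χⱼ ⟩
    sum χᵢ * sum χⱼ + ∑[ w < v ] (χᵢ w * χⱼ w) * r₀  ≡⟨ cong₂ (λ a c → a * c + ∑[ w < v ] (χᵢ w * χⱼ w) * r₀) (block-size i) (block-size j) ⟩
    k * k + ∑[ w < v ] (χᵢ w * χⱼ w) * r₀            ≡⟨ cong (λ c → k * k + c * r₀) ∑-χχ ⟩
    k * k + M * r₀                                   ∎
    where
    X = count (λ l → rel i l ==ᴿ intersecting ∧ rel l j ==ᴿ intersecting)
    M = meet i j
    C = ⟦ rel i j ==ᴿ intersecting ⟧
    χᵢ χⱼ : Fin v → ℕ
    χᵢ w = ⟦ w ∈ᴮ i ⟧
    χⱼ w = ⟦ w ∈ᴮ j ⟧
    Iᵢ Iⱼ : Fin b → ℕ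
    Iᵢ l = ⟦ rel l i ==ᴿ intersecting ⟧
    Iⱼ l = ⟦ rel l j ==ᴿ intersecting ⟧

    ∑-χχ : ∑[ w < v ] (χᵢ w * χⱼ w) ≡ M
    ∑-χχ = sum-cong-≗ (λ w → sym (⟦∧⟧ (w ∈ᴮ i) (w ∈ᴮ j)))

    ∑-I-meet : ∑[ l < b ] (Iᵢ l * meet l j) ≡ C * k + X
    ∑-I-meet = begin
      ∑[ l < b ] (Iᵢ l * meet l j)
        ≡⟨ sum-cong-≗ (λ l → trans (cong (Iᵢ l *_) (meet-decomposition l j))
             (solve 4 (λ a d k b → a :* (d :* k :+ b) := d :* (a :* k) :+ a :* b) refl (Iᵢ l) ⟦ j ≐ l ⟧ k (Iⱼ l))) ⟩
      ∑[ l < b ] (⟦ j ≐ l ⟧ * (Iᵢ l * k) + Iᵢ l * Iⱼ l)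
        ≡⟨ ∑-distrib-+ (λ l → ⟦ j ≐ l ⟧ * (Iᵢ l * k)) (λ l → Iᵢ l * Iⱼ l) ⟩
      ∑[ l < b ] (⟦ j ≐ l ⟧ * (Iᵢ l * k)) + ∑[ l < b ] (Iᵢ l * Iⱼ l)
        ≡⟨ cong₂ _+_ (∑-δ j (λ l → Iᵢ l * k)) (sum-cong-≗ both) ⟩
      Iᵢ j * k + X
        ≡⟨ cong (λ t → ⟦ t ==ᴿ intersecting ⟧ * k + X) (rel-sym j i) ⟩
      C * k + X ∎
      where
      both : ∀ l → Iᵢ l * Iⱼ l ≡ ⟦ rel i l ==ᴿ intersecting ∧ rel l j ==ᴿ intersecting ⟧
      both l = trans (cong (λ t → ⟦ t ==ᴿ intersecting ⟧ * Iⱼ l) (rel-sym l i))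
                     (sym (⟦∧⟧ (rel i l ==ᴿ intersecting) (rel l j ==ᴿ intersecting)))

    products : ∑[ l < b ] (weight χᵢ l * weight χⱼ l) ≡ k * M + (C * k + X)
    products = begin
      ∑[ l < b ] (weight χᵢ l * weight χⱼ l)
        ≡⟨ sum-cong-≗ (λ l → cong₂ _*_ (trans (weight-of-block i l) (meet-decomposition l i)) (weight-of-block j l)) ⟩
      ∑[ l < b ] ((⟦ i ≐ l ⟧ * k + Iᵢ l) * meet l j)
        ≡⟨ sum-cong-≗ (λ l → solve 4 (λ d k a m → (d :* k :+ a) :* m := d :* (k :* m) :+ a :* m) refl ⟦ i ≐ l ⟧ k (Iᵢ l) (meet l j)) ⟩
      ∑[ l < b ] (⟦ i ≐ l ⟧ * (k * meet l j) + Iᵢ l * meet l j)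
        ≡⟨ ∑-distrib-+ (λ l → ⟦ i ≐ l ⟧ * (k * meet l j)) (λ l → Iᵢ l * meet l j) ⟩
      ∑[ l < b ] (⟦ i ≐ l ⟧ * (k * meet l j)) + ∑[ l < b ] (Iᵢ l * meet l j)
        ≡⟨ cong₂ _+_ (∑-δ i (λ l → k * meet l j)) ∑-I-meet ⟩
      k * M + (C * k + X) ∎

bool-enumerated : Enumerated Bool
bool-enumerated = record
  { size        = 1
  ; enum        = λ { Fin.zero → false ; (Fin.suc _) → true }
  ; _==_        = _==ᵇ_
  ; ==-sound    = sound
  ; exactly-one = λ { false → refl ; true → refl }
  }
  where
  _==ᵇ_ : Bool → Bool → Bool
  a ==ᵇ true  = a
  a ==ᵇ false = not a
  sound : ∀ {a c} → (a ==ᵇ c) ≡ true → a ≡ c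
  sound {true}  {true}  _ = refl
  sound {false} {false} _ = refl

blockrel-enumerated : Enumerated BlockRel
blockrel-enumerated = record
  { size        = 2
  ; enum        = λ { Fin.zero → disjoint ; (Fin.suc Fin.zero) → identical ; (Fin.suc (Fin.suc Fin.zero)) → intersecting }
  ; _==_        = _==ᴿ_
  ; ==-sound    = λ {s} {t} → sound s t
  ; exactly-one = λ { identical → refl ; intersecting → refl ; disjoint → refl }
  }
  where
  sound : ∀ s t → (s ==ᴿ t) ≡ true → s ≡ t
  sound s t eq with s ≟ᴿ t
  ... | yes s≡t = s≡t
  sound s t () | no _

-- Each family is an instance of joint-determined, fed with
-- the counts of the design computed in Steiner.
module Intersections (v k b : ℕ) (B : Fin b → Subset v) (bibd : IsBIBD v k 1 b B) where
  open Steiner v k b B bibd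
  open Joint bool-enumerated bool-enumerated using () renaming (joint-determined to determined-𝔹𝔹)
  open Joint bool-enumerated blockrel-enumerated using () renaming (joint-determined to determined-𝔹ℛ)
  open Joint blockrel-enumerated blockrel-enumerated using () renaming (joint-determined to determined-ℛℛ)

  identical-to : ∀ j (p : Fin b → Bool) → count (λ l → p l ∧ rel l j ==ᴿ identical) ≡ ⟦ p j ⟧
  identical-to j p = trans (count-cong (λ l → cong (p l ∧_) (rel-identical l j))) (count-∧-δ j p)

  identical-from : ∀ i (p : Fin b → Bool) → count (λ l → rel i l ==ᴿ identical ∧ p l) ≡ ⟦ p i ⟧
  identical-from i p = trans (count-cong (λ l → cong (_∧ p l) (rel-identical i l))) (count-δ-∧ i p)

  meeting-blocks-same : ∀ j j′ → count (λ l → rel l j ==ᴿ intersecting) ≡ count (λ l → rel l j′ ==ᴿ intersecting)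
  meeting-blocks-same j j′ =
    +-cancelʳ-≡ k (count (λ l → rel l j ==ᴿ intersecting)) (count (λ l → rel l j′ ==ᴿ intersecting))
      (trans (meeting-blocks j) (sym (meeting-blocks j′)))

  points-pp : ∀ (G : Bool → Bool → Bool) (x y x′ y′ : Fin v) → (x ≐ y) ≡ (x′ ≐ y′) →
    count (λ w → G (x ≐ w) (w ≐ y)) ≡ count (λ w → G (x′ ≐ w) (w ≐ y′))
  points-pp G x y x′ y′ e = determined-𝔹𝔹 (x ≐_) (x′ ≐_) (_≐ y) (_≐ y′)
    (λ _ → trans (count-δ x) (sym (count-δ x′)))
    (λ _ → trans (count-∧-δ y (λ _ → true)) (sym (count-∧-δ y′ (λ _ → true))))
    (λ _ _ → same-by ⟦_⟧ (count-δ-∧ x (_≐ y)) (count-δ-∧ x′ (_≐ y′)) e) G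

  blocks-pp : ∀ (G : Bool → Bool → Bool) (x y x′ y′ : Fin v) → (x ≐ y) ≡ (x′ ≐ y′) →
    count (λ l → G (x ∈ᴮ l) (y ∈ᴮ l)) ≡ count (λ l → G (x′ ∈ᴮ l) (y′ ∈ᴮ l))
  blocks-pp G x y x′ y′ e = determined-𝔹𝔹 (x ∈ᴮ_) (x′ ∈ᴮ_) (y ∈ᴮ_) (y′ ∈ᴮ_)
    (λ _ → trans (replication x) (sym (replication x′)))
    (λ _ → trans (replication y) (sym (replication y′)))
    (λ _ _ → same-by (λ c → if c then r₀ else 1) (through-r₀ x y) (through-r₀ x′ y′) e) G

  points-pb : ∀ (G : Bool → Bool → Bool) (x : Fin v) (j : Fin b) (x′ : Fin v) (j′ : Fin b) → (x ∈ᴮ j) ≡ (x′ ∈ᴮ j′) →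
    count (λ w → G (x ≐ w) (w ∈ᴮ j)) ≡ count (λ w → G (x′ ≐ w) (w ∈ᴮ j′))
  points-pb G x j x′ j′ e = determined-𝔹𝔹 (x ≐_) (x′ ≐_) (_∈ᴮ j) (_∈ᴮ j′)
    (λ _ → trans (count-δ x) (sym (count-δ x′)))
    (λ _ → trans (block-size j) (sym (block-size j′)))
    (λ _ _ → same-by ⟦_⟧ (count-δ-∧ x (_∈ᴮ j)) (count-δ-∧ x′ (_∈ᴮ j′)) e) G

  blocks-pb : ∀ (G : Bool → BlockRel → Bool) (x : Fin v) (j : Fin b) (x′ : Fin v) (j′ : Fin b) → (x ∈ᴮ j) ≡ (x′ ∈ᴮ j′) →
    count (λ l → G (x ∈ᴮ l) (rel l j)) ≡ count (λ l → G (x′ ∈ᴮ l) (rel l j′))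
  blocks-pb G x j x′ j′ e = determined-𝔹ℛ (x ∈ᴮ_) (x′ ∈ᴮ_) (λ l → rel l j) (λ l → rel l j′)
    (λ _ → trans (replication x) (sym (replication x′)))
    (λ { Fin.zero → trans (identical-to j (λ _ → true)) (sym (identical-to j′ (λ _ → true)))
       ; (Fin.suc Fin.zero) → meeting-blocks-same j j′ })
    (λ { _ Fin.zero → same-by ⟦_⟧ (identical-to j (x ∈ᴮ_)) (identical-to j′ (x′ ∈ᴮ_)) e
       ; _ (Fin.suc Fin.zero) → same-by-cancel (λ m → ⟦ m ⟧ * k + ⟦ m ⟧) (λ m → k + ⟦ m ⟧ * r₀)
                                  (meeting-blocks-through x j) (meeting-blocks-through x′ j′) e })
    G

  points-bb : ∀ (G : Bool → Bool → Bool) (i j i′ j′ : Fin b) → rel i j ≡ rel i′ j′ →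
    count (λ w → G (w ∈ᴮ i) (w ∈ᴮ j)) ≡ count (λ w → G (w ∈ᴮ i′) (w ∈ᴮ j′))
  points-bb G i j i′ j′ e = determined-𝔹𝔹 (_∈ᴮ i) (_∈ᴮ i′) (_∈ᴮ j) (_∈ᴮ j′)
    (λ _ → trans (block-size i) (sym (block-size i′)))
    (λ _ → trans (block-size j) (sym (block-size j′)))
    (λ _ _ → same-by common (meet-common i j) (meet-common i′ j′) e) G

  blocks-bb : ∀ (G : BlockRel → BlockRel → Bool) (i j i′ j′ : Fin b) → rel i j ≡ rel i′ j′ →
    count (λ l → G (rel i l) (rel l j)) ≡ count (λ l → G (rel i′ l) (rel l j′))
  blocks-bb G i j i′ j′ e = determined-ℛℛ (rel i) (rel i′) (λ l → rel l j) (λ l → rel l j′)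
    (λ { Fin.zero → trans (count-cong (rel-identical i)) (trans (count-δ i) (sym (trans (count-cong (rel-identical i′)) (count-δ i′))))
       ; (Fin.suc Fin.zero) → trans (count-cong (λ l → cong (_==ᴿ intersecting) (rel-sym i l)))
                                (trans (meeting-blocks-same i i′) (count-cong (λ l → cong (_==ᴿ intersecting) (rel-sym l i′)))) })
    (λ { Fin.zero → trans (identical-to j (λ _ → true)) (sym (identical-to j′ (λ _ → true)))
       ; (Fin.suc Fin.zero) → meeting-blocks-same j j′ })
    (λ { Fin.zero Fin.zero → same-by (λ t → ⟦ t ==ᴿ identical ⟧) (identical-from i (λ l → rel l j ==ᴿ identical))
                                      (identical-from i′ (λ l → rel l j′ ==ᴿ identical)) e
       ; Fin.zero (Fin.suc Fin.zero) → same-by (λ t → ⟦ t ==ᴿ intersecting ⟧) (identical-from i (λ l → rel l j ==ᴿ intersecting))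
                                            (identical-from i′ (λ l → rel l j′ ==ᴿ intersecting)) e
       ; (Fin.suc Fin.zero) Fin.zero → same-by (λ t → ⟦ t ==ᴿ intersecting ⟧) (identical-to j (λ l → rel i l ==ᴿ intersecting))
                                            (identical-to j′ (λ l → rel i′ l ==ᴿ intersecting)) e
       ; (Fin.suc Fin.zero) (Fin.suc Fin.zero) → same-by-cancel h f (meeting-both-by-rel i j) (meeting-both-by-rel i′ j′) e })
    G
    where
    h f : BlockRel → ℕ
    h t = k * common t + ⟦ t ==ᴿ intersecting ⟧ * k + common t
    f t = k * k + common t * r₀
    meeting-both-by-rel : ∀ i j → count (λ l → rel i l ==ᴿ intersecting ∧ rel l j ==ᴿ intersecting) + h (rel i j) ≡ f (rel i j)
    meeting-both-by-rel i j = subst (λ M → count (λ l → rel i l ==ᴿ intersecting ∧ rel l j ==ᴿ intersecting)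
                                               + (k * M + ⟦ rel i j ==ᴿ intersecting ⟧ * k + M) ≡ k * k + M * r₀)
                                    (meet-common i j) (meeting-both i j)

  -- The block–point families are the point–block ones read backwards.
  points-bp : ∀ (G : Bool → Bool → Bool) (i : Fin b) (y : Fin v) (i′ : Fin b) (y′ : Fin v) → (y ∈ᴮ i) ≡ (y′ ∈ᴮ i′) →
    count (λ w → G (w ∈ᴮ i) (w ≐ y)) ≡ count (λ w → G (w ∈ᴮ i′) (w ≐ y′))
  points-bp G i y i′ y′ e = begin
    count (λ w → G (w ∈ᴮ i) (w ≐ y))    ≡⟨ count-cong (λ w → cong (G (w ∈ᴮ i)) (≐-sym w y)) ⟩
    count (λ w → G (w ∈ᴮ i) (y ≐ w))    ≡⟨ points-pb (λ a c → G c a) y i y′ i′ e ⟩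
    count (λ w → G (w ∈ᴮ i′) (y′ ≐ w))  ≡⟨ count-cong (λ w → cong (G (w ∈ᴮ i′)) (≐-sym y′ w)) ⟩
    count (λ w → G (w ∈ᴮ i′) (w ≐ y′))  ∎
    where open ≡-Reasoning

  blocks-bp : ∀ (G : BlockRel → Bool → Bool) (i : Fin b) (y : Fin v) (i′ : Fin b) (y′ : Fin v) → (y ∈ᴮ i) ≡ (y′ ∈ᴮ i′) →
    count (λ l → G (rel i l) (y ∈ᴮ l)) ≡ count (λ l → G (rel i′ l) (y′ ∈ᴮ l))
  blocks-bp G i y i′ y′ e = begin
    count (λ l → G (rel i l) (y ∈ᴮ l))    ≡⟨ count-cong (λ l → cong (λ t → G t (y ∈ᴮ l)) (rel-sym i l)) ⟩
    count (λ l → G (rel l i) (y ∈ᴮ l))    ≡⟨ blocks-pb (λ a t → G t a) y i y′ i′ e ⟩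
    count (λ l → G (rel l i′) (y′ ∈ᴮ l))  ≡⟨ count-cong (λ l → cong (λ t → G t (y′ ∈ᴮ l)) (rel-sym l i′)) ⟩
    count (λ l → G (rel i′ l) (y′ ∈ᴮ l))  ∎
    where open ≡-Reasoning

-- Classes of ordered pairs of vertices of the incidence graph: equality of
-- two points, incidence of a point and a block (either order), and the
-- relation of two blocks.
PairClass : Set
PairClass = (Bool ⊎ Bool) ⊎ (Bool ⊎ BlockRel)

pattern point-point e = inj₁ (inj₁ e)
pattern point-block e = inj₁ (inj₂ e)
pattern block-point e = inj₂ (inj₁ e)
pattern block-block t = inj₂ (inj₂ t)

_≟ᶜ_ : DecidableEquality PairClass
_≟ᶜ_ = ≡-dec (≡-dec Bool._≟_ Bool._≟_) (≡-dec Bool._≟_ _≟ᴿ_)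

diagonal : PairClass → Bool
diagonal (point-point e) = e
diagonal (point-block _) = false
diagonal (block-point _) = false
diagonal (block-block t) = t ==ᴿ identical

edge? : PairClass → Bool
edge? (point-point _) = false
edge? (point-block e) = e
edge? (block-point e) = e
edge? (block-block _) = false

colour₀ : Bool → Bool → Colour₀
colour₀ true  _     = vertex
colour₀ false true  = edge
colour₀ false false = non-edge

count-splitAt : ∀ v {b} (h : Fin v ⊎ Fin b → Bool) →
  count (λ z → h (splitAt v z)) ≡ count (λ x → h (inj₁ x)) + count (λ i → h (inj₂ i))
count-splitAt v {b} h = trans (∑-↑ v (λ z → ⟦ h (splitAt v z) ⟧))
  (cong₂ _+_ (sum-cong-≗ (λ x → cong (λ s → ⟦ h s ⟧) (splitAt-↑ˡ v x b)))
             (sum-cong-≗ (λ i → cong (λ s → ⟦ h s ⟧) (splitAt-↑ʳ v b i))))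

does-splitAt : ∀ v {b} (u w : Fin (v + b)) → does (u ≟ w) ≡ does (≡-dec _≟_ _≟_ (splitAt v u) (splitAt v w))
does-splitAt v {b} u w with u ≟ w | ≡-dec _≟_ _≟_ (splitAt v u) (splitAt v w)
... | yes _   | yes _  = refl
... | no _    | no _   = refl
... | yes u≡w | no ≢   = contradiction (cong (splitAt v) u≡w) ≢
... | no u≢w  | yes eq = contradiction (trans (sym (join-splitAt v b u)) (trans (cong (join v b) eq) (join-splitAt v b w))) u≢w

module IncidenceGraph (v k b : ℕ) (B : Fin b → Subset v) (bibd : IsBIBD v k 1 b B) where
  open Steiner v k b B bibd
  open Intersections v k b B bibd
  open WL (v + b) (incidenceAdj B)
  open Refinement (v + b) (incidenceAdj B)

  classify : Fin v ⊎ Fin b → Fin v ⊎ Fin b → PairClass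
  classify (inj₁ x) (inj₁ y) = point-point (x ≐ y)
  classify (inj₁ x) (inj₂ j) = point-block (x ∈ᴮ j)
  classify (inj₂ i) (inj₁ y) = block-point (y ∈ᴮ i)
  classify (inj₂ i) (inj₂ j) = block-block (rel i j)

  cls : Pair → PairClass
  cls (u , w) = classify (splitAt v u) (splitAt v w)

  diagonal-classify : ∀ s t → does (≡-dec _≟_ _≟_ s t) ≡ diagonal (classify s t)
  diagonal-classify (inj₁ x) (inj₁ y) = refl
  diagonal-classify (inj₁ x) (inj₂ j) = refl
  diagonal-classify (inj₂ i) (inj₁ y) = refl
  diagonal-classify (inj₂ i) (inj₂ j) = sym (rel-identical i j)

  edge-classify : ∀ u w → incidenceAdj B u w ≡ edge? (cls (u , w))
  edge-classify u w with splitAt v u | splitAt v w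
  ... | inj₁ x | inj₁ y = refl
  ... | inj₁ x | inj₂ j = refl
  ... | inj₂ i | inj₁ y = refl
  ... | inj₂ i | inj₂ j = refl

  c₀-by-class : ∀ p → c₀ p ≡ colour₀ (diagonal (cls p)) (edge? (cls p))
  c₀-by-class (u , w) = trans shape
    (cong₂ colour₀ (trans (does-splitAt v u w) (diagonal-classify (splitAt v u) (splitAt v w))) (edge-classify u w))
    where
    shape : c₀ (u , w) ≡ colour₀ (does (u ≟ w)) (incidenceAdj B u w)
    shape with does (u ≟ w) | incidenceAdj B u w
    ... | true  | _     = refl
    ... | false | true  = refl
    ... | false | false = refl

  -- Intersection numbers, split by the side of the middle vertex; the block–point
  -- families are read backwards from the point–block ones.
  sides : ∀ (F : PairClass → PairClass → Bool) s t s′ t′ → classify s t ≡ classify s′ t′ →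
    count (λ w → F (classify s (inj₁ w)) (classify (inj₁ w) t)) + count (λ l → F (classify s (inj₂ l)) (classify (inj₂ l) t))
    ≡ count (λ w → F (classify s′ (inj₁ w)) (classify (inj₁ w) t′)) + count (λ l → F (classify s′ (inj₂ l)) (classify (inj₂ l) t′))
  sides F (inj₁ x) (inj₁ y) (inj₁ x′) (inj₁ y′) e = cong₂ _+_
    (points-pp (λ a c → F (point-point a) (point-point c)) x y x′ y′ (inj₁-injective (inj₁-injective e)))
    (blocks-pp (λ a c → F (point-block a) (block-point c)) x y x′ y′ (inj₁-injective (inj₁-injective e)))
  sides F (inj₁ x) (inj₂ j) (inj₁ x′) (inj₂ j′) e = cong₂ _+_
    (points-pb (λ a c → F (point-point a) (point-block c)) x j x′ j′ (inj₂-injective (inj₁-injective e)))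
    (blocks-pb (λ a t → F (point-block a) (block-block t)) x j x′ j′ (inj₂-injective (inj₁-injective e)))
  sides F (inj₂ i) (inj₁ y) (inj₂ i′) (inj₁ y′) e = cong₂ _+_
    (points-bp (λ a c → F (block-point a) (point-point c)) i y i′ y′ (inj₁-injective (inj₂-injective e)))
    (blocks-bp (λ t a → F (block-block t) (block-point a)) i y i′ y′ (inj₁-injective (inj₂-injective e)))
  sides F (inj₂ i) (inj₂ j) (inj₂ i′) (inj₂ j′) e = cong₂ _+_
    (points-bb (λ a c → F (block-point a) (point-block c)) i j i′ j′ (inj₂-injective (inj₂-injective e)))
    (blocks-bb (λ t u → F (block-block t) (block-block u)) i j i′ j′ (inj₂-injective (inj₂-injective e)))
  sides F (inj₁ _) (inj₁ _) (inj₁ _) (inj₂ _) ()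
  sides F (inj₁ _) (inj₁ _) (inj₂ _) (inj₁ _) ()
  sides F (inj₁ _) (inj₁ _) (inj₂ _) (inj₂ _) ()
  sides F (inj₁ _) (inj₂ _) (inj₁ _) (inj₁ _) ()
  sides F (inj₁ _) (inj₂ _) (inj₂ _) (inj₁ _) ()
  sides F (inj₁ _) (inj₂ _) (inj₂ _) (inj₂ _) ()
  sides F (inj₂ _) (inj₁ _) (inj₁ _) (inj₁ _) ()
  sides F (inj₂ _) (inj₁ _) (inj₁ _) (inj₂ _) ()
  sides F (inj₂ _) (inj₁ _) (inj₂ _) (inj₂ _) ()
  sides F (inj₂ _) (inj₂ _) (inj₁ _) (inj₁ _) ()
  sides F (inj₂ _) (inj₂ _) (inj₁ _) (inj₂ _) ()
  sides F (inj₂ _) (inj₂ _) (inj₂ _) (inj₁ _) ()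

  coherent : Coherent cls
  coherent = record
    { _≟ᶜ_         = _≟ᶜ_
    ; initial      = λ p q e → trans (c₀-by-class p)
                                 (trans (cong (λ c → colour₀ (diagonal c) (edge? c)) e) (sym (c₀-by-class q)))
    ; intersection = λ F x y x′ y′ e → trans (by-sides F x y) (trans (sides F _ _ _ _ e) (sym (by-sides F x′ y′)))
    }
    where
    by-sides : ∀ F x y → count (λ z → F (cls (x , z)) (cls (z , y))) ≡
      count (λ w → F (classify (splitAt v x) (inj₁ w)) (classify (inj₁ w) (splitAt v y)))
      + count (λ l → F (classify (splitAt v x) (inj₂ l)) (classify (inj₂ l) (splitAt v y)))
    by-sides F x y = count-splitAt v (λ s → F (classify (splitAt v x) s) (classify s (splitAt v y)))

  points-alike : ∀ x y → cls (x ↑ˡ b , x ↑ˡ b) ≡ cls (y ↑ˡ b , y ↑ˡ b)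
  points-alike x y rewrite splitAt-↑ˡ v x b | splitAt-↑ˡ v y b =
    cong point-point (trans (≐-refl x) (sym (≐-refl y)))

  blocks-alike : ∀ i i′ → cls (v ↑ʳ i , v ↑ʳ i) ≡ cls (v ↑ʳ i′ , v ↑ʳ i′)
  blocks-alike i i′ rewrite splitAt-↑ʳ v b i | splitAt-↑ʳ v b i′ =
    cong block-block (trans (cong₂ relate (≐-refl i) refl) (sym (cong₂ relate (≐-refl i′) refl)))

proposition3p1 : (v k b : ℕ) (B : Fin b → Subset v) → IsBIBD v k 1 b B →
    ((x y : Fin v) (j : ℕ) →
      WL.sameVertexColour (v + b) (incidenceAdj B) j (x ↑ˡ b) (y ↑ˡ b) ≡ true)
    × ((i i′ : Fin b) (j : ℕ) →
      WL.sameVertexColour (v + b) (incidenceAdj B) j (v ↑ʳ i) (v ↑ʳ i′) ≡ true)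
proposition3p1 v k b B bibd =
    (λ x y j → stable-refines coherent j _ _ (points-alike x y))
  , (λ i i′ j → stable-refines coherent j _ _ (blocks-alike i i′))
  where
  open IncidenceGraph v k b B bibd
  open Refinement (v + b) (incidenceAdj B)
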